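{- For every integer $n\geq 2$, $C_n(0)=1$ and $C_n(-1)=(n-1)!\,B_n(0)=\frac{(-1)^n}{n-1}$.
   Context: The polynomials $B_n\in\mathbb{Q}[s]$ are defined by $B_1=0$ and, for $n\geq 1$, $B_{n+1}$ is the unique polynomial with $B_{n+1}(1)=0$ and $B_{n+1}'(s)=B_n(s)-\frac{s^{n-1}}{n!}$. For $n\geq 2$, $B_n(1)=0$, and the polynomial $C_n$ (of degree $n-2$) is defined by $B_n(s)=-\frac{1}{(n-1)!}(s-1)C_n(s-1)$. -}

module Defs where

open import Data.Nat using (ℕ; zero; suc; _!; pred)
open import Data.Nat.Properties using (_!≢0)
open import Data.Integer using (ℤ; +_)
open import Data.Rational using (ℚ; 0ℚ; 1ℚ; _+_; _*_; -_; _/_)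
open import Data.List using (List; []; _∷_; replicate; _++_)

-- Polynomials over ℚ as coefficient lists, lowest degree first.
Poly : Set
Poly = List ℚ

eval : Poly → ℚ → ℚ
eval []      x = 0ℚ
eval (a ∷ p) x = a + x * eval p x

_⊕_ : Poly → Poly → Poly
[]      ⊕ q       = q
(a ∷ p) ⊕ []      = a ∷ p
(a ∷ p) ⊕ (b ∷ q) = (a + b) ∷ (p ⊕ q)

scale : ℚ → Poly → Poly
scale c []      = []
scale c (a ∷ p) = (c * a) ∷ scale c p

_⊖_ : Poly → Poly → Poly
p ⊖ q = p ⊕ scale (- 1ℚ) q

monomial : ℕ → ℚ → Poly
monomial k c = replicate k 0ℚ ++ (c ∷ [])

integ-from : ℕ → Poly → Poly
integ-from i []      = []
integ-from i (a ∷ p) = (a * (+ 1 / suc i)) ∷ integ-from (suc i) p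

integ : Poly → Poly
integ p = 0ℚ ∷ integ-from 0 p

fact : ℕ → ℚ
fact k = + (k !) / 1

-- Bpoly k = B_{k+1}.
-- B_1 = 0; B_{n+1} = the antiderivative of B_n - s^{n-1}/n! vanishing at 1
-- (with n = k+1, s^{n-1}/n! = s^k/(k+1)!).
Bpoly : ℕ → Poly
Bpoly zero    = []
Bpoly (suc k) =
  let Q = integ (Bpoly k ⊖ monomial k ((+ 1 / ((suc k) !)) {{(suc k) !≢0}}))
  in Q ⊖ (eval Q 1ℚ ∷ [])

-- B n = B_n  (for n ≥ 1; B 0 is a junk value = B_1)
B : ℕ → Poly
B zero    = Bpoly zero
B (suc k) = Bpoly k

-- Taylor shift: shift p (t) = p(t+1)
mulX+1 : Poly → Poly
mulX+1 q = (0ℚ ∷ q) ⊕ q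

shift : Poly → Poly
shift []      = []
shift (a ∷ p) = (a ∷ []) ⊕ mulX+1 (shift p)

tail' : Poly → Poly
tail' []      = []
tail' (_ ∷ p) = p

-- C_n for n = m + 2, defined by B_n(s) = -(1/(n-1)!) (s-1) C_n(s-1):
-- B_n(t+1) = -(1/(n-1)!) t C_n(t), and B_n(1) = 0, so
-- C_n = -(n-1)! · (B_n(t+1) with its (zero) constant term removed, divided by t).
C : ℕ → Poly
C n = scale (- fact (pred n)) (tail' (shift (B n)))

{-# OPTIONS --safe #-}
-- Let θ = s d/ds be the Euler operator. By induction on n, (θ − (n−1)) B_n equals
-- E_{n−1} = ((s−1)^{n−1} − s^{n−1})/(n−1)!: for n ≥ 2 both sides have derivative
-- (θ − (n−2)) B_{n−1} = E_{n−2} (θ − (n−2) kills s^{n−2}), and both take the value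
-- −1/(n−1)! at s = 1, because B_n(1) = 0 and B_n′(1) = B_{n−1}(1) − 1/(n−1)!.
-- The constant term of this identity gives −(n−1) B_n(0) = (−1)^{n−1}/(n−1)!.
-- As (s−1) C_n(s−1) = −(n−1)! B_n(s), C_n(0) = −(n−1)! B_n′(1) = 1 and
-- C_n(−1) = (n−1)! B_n(0).
module Submission where

open import Defs
open import Data.Nat as ℕ using (ℕ; zero; suc; _!)
open import Data.Nat.Properties as ℕ using (_!≢0; m*n≢0)
open import Data.Integer as ℤ using (+_; -[1+_]; _^_)
open import Data.Integer.Properties as ℤ using ()
import Data.Integer.Tactic.RingSolver as ℤ-Solver
open import Data.Rational using (ℚ; 0ℚ; 1ℚ; _+_; _*_; -_; _-_; _/_; toℚᵘ)
open import Data.Rational.Properties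
  using ( _≟_; +-*-commutativeRing; +-0-group; +-identityˡ; +-identityʳ; +-inverseˡ; +-inverseʳ
        ; +-assoc; *-identityˡ; *-identityʳ; *-zeroˡ; *-zeroʳ; *-assoc
        ; toℚᵘ-injective; toℚᵘ-fromℚᵘ; toℚᵘ-homo-+; toℚᵘ-homo-* )
import Data.Rational.Unnormalised as ℚᵘ
import Data.Rational.Unnormalised.Properties as ℚᵘ
open import Algebra.Properties.Group +-0-group using () renaming (∙-cancelʳ to +-cancelʳ)
open import Data.List using ([]; _∷_)
open import Data.Product using (_×_; _,_)
open import Function using (_∘_)
open import Level using (0ℓ)
open import Relation.Binary.PropositionalEquality
open import Relation.Nullary.Decidable using (dec⇒maybe)
open import Tactic.RingSolver using (solve-∀)
open import Tactic.RingSolver.Core.AlmostCommutativeRing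
  using (AlmostCommutativeRing; fromCommutativeRing)

open ≡-Reasoning

ℚ-ring : AlmostCommutativeRing 0ℓ 0ℓ
ℚ-ring = fromCommutativeRing +-*-commutativeRing (dec⇒maybe ∘ (0ℚ ≟_))

ι : ℕ → ℚ
ι n = + n / 1

ι⁻¹ : (n : ℕ) .{{_ : ℕ.NonZero n}} → ℚ
ι⁻¹ n = + 1 / n

toℚᵘ-/ : ∀ z d → toℚᵘ (z / suc d) ℚᵘ.≃ ℚᵘ.mkℚᵘ z d
toℚᵘ-/ z d = toℚᵘ-fromℚᵘ (ℚᵘ.mkℚᵘ z d)

/1-homo-+ : ∀ z w → (z ℤ.+ w) / 1 ≡ (z / 1) + (w / 1)
/1-homo-+ z w = toℚᵘ-injective (ℚᵘ.≃-trans (toℚᵘ-/ (z ℤ.+ w) 0) (ℚᵘ.≃-sym (ℚᵘ.≃-trans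
  (toℚᵘ-homo-+ (z / 1) (w / 1)) (ℚᵘ.≃-trans (ℚᵘ.+-cong (toℚᵘ-/ z 0) (toℚᵘ-/ w 0)) (ℚᵘ.*≡* (eq z w))))))
  where
  eq : ∀ z w → (z ℤ.* + 1 ℤ.+ w ℤ.* + 1) ℤ.* + 1 ≡ (z ℤ.+ w) ℤ.* + 1
  eq = ℤ-Solver.solve-∀

/1-homo-* : ∀ z w → (z ℤ.* w) / 1 ≡ (z / 1) * (w / 1)
/1-homo-* z w = toℚᵘ-injective (ℚᵘ.≃-trans (toℚᵘ-/ (z ℤ.* w) 0) (ℚᵘ.≃-sym (ℚᵘ.≃-trans
  (toℚᵘ-homo-* (z / 1) (w / 1)) (ℚᵘ.*-cong (toℚᵘ-/ z 0) (toℚᵘ-/ w 0)))))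

/-as-*ι⁻¹ : ∀ z n .{{_ : ℕ.NonZero n}} → z / n ≡ (z / 1) * ι⁻¹ n
/-as-*ι⁻¹ z (suc d) = toℚᵘ-injective (ℚᵘ.≃-trans (toℚᵘ-/ z d) (ℚᵘ.≃-sym (ℚᵘ.≃-trans
  (toℚᵘ-homo-* (z / 1) (ι⁻¹ (suc d)))
  (ℚᵘ.≃-trans (ℚᵘ.*-cong (toℚᵘ-/ z 0) (toℚᵘ-/ (+ 1) d)) (ℚᵘ.*≡* (ℤ.*-assoc z (+ 1) (+ suc d)))))))

n/n≡1 : ∀ n .{{_ : ℕ.NonZero n}} → + n / n ≡ 1ℚ
n/n≡1 (suc d) = toℚᵘ-injective (ℚᵘ.≃-trans (toℚᵘ-/ (+ suc d) d) (ℚᵘ.*≡* (ℤ.*-comm (+ suc d) (+ 1))))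

ι⁻¹-* : ∀ m n .{{_ : ℕ.NonZero m}} .{{_ : ℕ.NonZero n}} →
        ι⁻¹ m * ι⁻¹ n ≡ ι⁻¹ (m ℕ.* n) {{m*n≢0 m n}}
ι⁻¹-* (suc a) (suc b) = toℚᵘ-injective (ℚᵘ.≃-trans (toℚᵘ-homo-* (ι⁻¹ (suc a)) (ι⁻¹ (suc b)))
  (ℚᵘ.≃-trans (ℚᵘ.*-cong (toℚᵘ-/ (+ 1) a) (toℚᵘ-/ (+ 1) b)) (ℚᵘ.≃-sym (toℚᵘ-/ (+ 1) (b ℕ.+ a ℕ.* suc b)))))

ι-suc : ∀ n → ι (suc n) ≡ 1ℚ + ι n
ι-suc n = /1-homo-+ (+ 1) (+ n)

ι*ι⁻¹ : ∀ n .{{_ : ℕ.NonZero n}} → ι n * ι⁻¹ n ≡ 1ℚ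
ι*ι⁻¹ n = trans (sym (/-as-*ι⁻¹ (+ n) n)) (n/n≡1 n)

ι*[x*ι⁻¹] : ∀ n .{{_ : ℕ.NonZero n}} x → ι n * (x * ι⁻¹ n) ≡ x
ι*[x*ι⁻¹] n x = begin
  ι n * (x * ι⁻¹ n)   ≡⟨ swap (ι n) x (ι⁻¹ n) ⟩
  x * (ι n * ι⁻¹ n)   ≡⟨ cong (x *_) (ι*ι⁻¹ n) ⟩
  x * 1ℚ              ≡⟨ *-identityʳ x ⟩
  x                   ∎
  where
  swap : ∀ a b c → a * (b * c) ≡ b * (a * c)
  swap = solve-∀ ℚ-ring

ι-cross : ∀ m n .{{_ : ℕ.NonZero m}} .{{_ : ℕ.NonZero n}} {x y} →
          ι n * x ≡ ι m * y → ι⁻¹ m * x ≡ y * ι⁻¹ n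
ι-cross m n {x} {y} eq = begin
  ι⁻¹ m * x                            ≡⟨ sym (ι*[x*ι⁻¹] n (ι⁻¹ m * x)) ⟩
  ι n * (ι⁻¹ m * x * ι⁻¹ n)             ≡⟨ shuffle (ι n) (ι⁻¹ m) x (ι⁻¹ n) ⟩
  ι⁻¹ m * (ι n * x) * ι⁻¹ n             ≡⟨ cong (λ t → ι⁻¹ m * t * ι⁻¹ n) eq ⟩
  ι⁻¹ m * (ι m * y) * ι⁻¹ n             ≡⟨ shuffle′ (ι⁻¹ m) (ι m) y (ι⁻¹ n) ⟩
  (ι m * ι⁻¹ m) * (y * ι⁻¹ n)           ≡⟨ cong (_* (y * ι⁻¹ n)) (ι*ι⁻¹ m) ⟩
  1ℚ * (y * ι⁻¹ n)                      ≡⟨ *-identityˡ _ ⟩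
  y * ι⁻¹ n                             ∎
  where
  shuffle : ∀ a b c d → a * (b * c * d) ≡ b * (a * c) * d
  shuffle = solve-∀ ℚ-ring
  shuffle′ : ∀ a b c d → a * (b * c) * d ≡ (b * a) * (c * d)
  shuffle′ = solve-∀ ℚ-ring

invFact : ℕ → ℚ
invFact k = (+ 1 / k !) {{k !≢0}}

fact*invFact : ∀ k → fact k * invFact k ≡ 1ℚ
fact*invFact k = ι*ι⁻¹ (k !) {{k !≢0}}

invFact-suc : ∀ k → invFact (suc k) ≡ ι⁻¹ (suc k) * invFact k
invFact-suc k = sym (ι⁻¹-* (suc k) (k !) {{_}} {{k !≢0}})

sign : ℕ → ℚ
sign k = (-[1+ 0 ] ^ k) / 1

sign-suc : ∀ k → sign (suc k) ≡ - sign k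
sign-suc k = begin
  sign (suc k)       ≡⟨ /1-homo-* -[1+ 0 ] (-[1+ 0 ] ^ k) ⟩
  - 1ℚ * sign k      ≡⟨ neg-one (sign k) ⟩
  - sign k           ∎
  where
  neg-one : ∀ a → - 1ℚ * a ≡ - a
  neg-one = solve-∀ ℚ-ring

coeff : Poly → ℕ → ℚ
coeff []      i       = 0ℚ
coeff (a ∷ p) zero    = a
coeff (a ∷ p) (suc i) = coeff p i

infix 4 _≈_
_≈_ : Poly → Poly → Set
p ≈ q = ∀ i → coeff p i ≡ coeff q i

coeff-⊕ : ∀ p q i → coeff (p ⊕ q) i ≡ coeff p i + coeff q i
coeff-⊕ []      q       i       = sym (+-identityˡ _)
coeff-⊕ (a ∷ p) []      i       = sym (+-identityʳ _)
coeff-⊕ (a ∷ p) (b ∷ q) zero    = refl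
coeff-⊕ (a ∷ p) (b ∷ q) (suc i) = coeff-⊕ p q i

coeff-scale : ∀ c p i → coeff (scale c p) i ≡ c * coeff p i
coeff-scale c []      i       = sym (*-zeroʳ c)
coeff-scale c (a ∷ p) zero    = refl
coeff-scale c (a ∷ p) (suc i) = coeff-scale c p i

coeff-⊖ : ∀ p q i → coeff (p ⊖ q) i ≡ coeff p i - coeff q i
coeff-⊖ p q i = begin
  coeff (p ⊖ q) i                       ≡⟨ coeff-⊕ p (scale (- 1ℚ) q) i ⟩
  coeff p i + coeff (scale (- 1ℚ) q) i  ≡⟨ cong (λ t → coeff p i + t) (coeff-scale (- 1ℚ) q i) ⟩
  coeff p i + - 1ℚ * coeff q i          ≡⟨ sub (coeff p i) (coeff q i) ⟩
  coeff p i - coeff q i                 ∎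
  where
  sub : ∀ a b → a + - 1ℚ * b ≡ a - b
  sub = solve-∀ ℚ-ring

coeff-⊖-const : ∀ p a j → coeff (p ⊖ (a ∷ [])) (suc j) ≡ coeff p (suc j)
coeff-⊖-const p a j = trans (coeff-⊖ p (a ∷ []) (suc j)) (+-identityʳ (coeff p (suc j)))

coeff-integ-from : ∀ i p j → coeff (integ-from i p) j ≡ coeff p j * ι⁻¹ (suc (j ℕ.+ i))
coeff-integ-from i []      j       = sym (*-zeroˡ (ι⁻¹ (suc (j ℕ.+ i))))
coeff-integ-from i (a ∷ p) zero    = refl
coeff-integ-from i (a ∷ p) (suc j) =
  trans (coeff-integ-from (suc i) p j) (cong (λ t → coeff p j * ι⁻¹ (suc t)) (ℕ.+-suc j i))

coeff-integ : ∀ p j → coeff (integ p) (suc j) ≡ coeff p j * ι⁻¹ (suc j)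
coeff-integ p j = trans (coeff-integ-from 0 p j) (cong (λ t → coeff p j * ι⁻¹ (suc t)) (ℕ.+-identityʳ j))

coeff-monomial-supp : ∀ k a j (f : ℕ → ℚ) →
                      coeff (monomial k a) j * f j ≡ coeff (monomial k a) j * f k
coeff-monomial-supp zero    a zero    f = refl
coeff-monomial-supp zero    a (suc j) f = trans (*-zeroˡ (f (suc j))) (sym (*-zeroˡ (f 0)))
coeff-monomial-supp (suc k) a zero    f = trans (*-zeroˡ (f 0)) (sym (*-zeroˡ (f (suc k))))
coeff-monomial-supp (suc k) a (suc j) f = coeff-monomial-supp k a j (f ∘ suc)

eval-[0] : ∀ x → eval (0ℚ ∷ []) x ≡ 0ℚ
eval-[0] x = trans (+-identityˡ (x * 0ℚ)) (*-zeroʳ x)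

eval-≈ : ∀ p q x → p ≈ q → eval p x ≡ eval q x
eval-≈ []      []      x h = refl
eval-≈ []      (b ∷ q) x h = begin
  0ℚ                 ≡⟨ sym (eval-[0] x) ⟩
  0ℚ + x * 0ℚ        ≡⟨ cong₂ (λ u v → u + x * v) (h 0) (eval-≈ [] q x (h ∘ suc)) ⟩
  b + x * eval q x   ∎
eval-≈ (a ∷ p) []      x h = begin
  a + x * eval p x   ≡⟨ cong₂ (λ u v → u + x * v) (h 0) (eval-≈ p [] x (h ∘ suc)) ⟩
  0ℚ + x * 0ℚ        ≡⟨ eval-[0] x ⟩
  0ℚ                 ∎
eval-≈ (a ∷ p) (b ∷ q) x h = cong₂ (λ u v → u + x * v) (h 0) (eval-≈ p q x (h ∘ suc))

eval-⊕ : ∀ p q x → eval (p ⊕ q) x ≡ eval p x + eval q x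
eval-⊕ []      q       x = sym (+-identityˡ _)
eval-⊕ (a ∷ p) []      x = sym (+-identityʳ _)
eval-⊕ (a ∷ p) (b ∷ q) x = begin
  (a + b) + x * eval (p ⊕ q) x            ≡⟨ cong (λ t → (a + b) + x * t) (eval-⊕ p q x) ⟩
  (a + b) + x * (eval p x + eval q x)     ≡⟨ regroup a b x (eval p x) (eval q x) ⟩
  (a + x * eval p x) + (b + x * eval q x) ∎
  where
  regroup : ∀ a b x u v → (a + b) + x * (u + v) ≡ (a + x * u) + (b + x * v)
  regroup = solve-∀ ℚ-ring

eval-scale : ∀ c p x → eval (scale c p) x ≡ c * eval p x
eval-scale c []      x = sym (*-zeroʳ c)
eval-scale c (a ∷ p) x = begin
  c * a + x * eval (scale c p) x  ≡⟨ cong (λ t → c * a + x * t) (eval-scale c p x) ⟩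
  c * a + x * (c * eval p x)      ≡⟨ factor c a x (eval p x) ⟩
  c * (a + x * eval p x)          ∎
  where
  factor : ∀ c a x u → c * a + x * (c * u) ≡ c * (a + x * u)
  factor = solve-∀ ℚ-ring

eval-⊖ : ∀ p q x → eval (p ⊖ q) x ≡ eval p x - eval q x
eval-⊖ p q x = begin
  eval (p ⊖ q) x                        ≡⟨ eval-⊕ p (scale (- 1ℚ) q) x ⟩
  eval p x + eval (scale (- 1ℚ) q) x    ≡⟨ cong (λ t → eval p x + t) (eval-scale (- 1ℚ) q x) ⟩
  eval p x + - 1ℚ * eval q x            ≡⟨ sub (eval p x) (eval q x) ⟩
  eval p x - eval q x                   ∎
  where
  sub : ∀ a b → a + - 1ℚ * b ≡ a - b
  sub = solve-∀ ℚ-ring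

eval-monomial-1 : ∀ k a → eval (monomial k a) 1ℚ ≡ a
eval-monomial-1 zero    a = trans (cong (λ t → a + t) (*-zeroʳ 1ℚ)) (+-identityʳ a)
eval-monomial-1 (suc k) a = trans (+-identityˡ _) (trans (*-identityˡ _) (eval-monomial-1 k a))

coeff-tail : ∀ p j → coeff (tail' p) j ≡ coeff p (suc j)
coeff-tail []      j = refl
coeff-tail (a ∷ p) j = refl

eval-tail : ∀ p x → eval p x ≡ coeff p 0 + x * eval (tail' p) x
eval-tail []      x = sym (eval-[0] x)
eval-tail (a ∷ p) x = refl

eval-0 : ∀ p → eval p 0ℚ ≡ coeff p 0
eval-0 p = trans (eval-tail p 0ℚ) (trans (cong (λ t → coeff p 0 + t) (*-zeroˡ (eval (tail' p) 0ℚ))) (+-identityʳ _))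

≈-from-tail-and-eval : ∀ p q x → (∀ j → coeff p (suc j) ≡ coeff q (suc j)) →
                       eval p x ≡ eval q x → p ≈ q
≈-from-tail-and-eval p q x tails eq zero = +-cancelʳ (x * eval (tail' q) x) (coeff p 0) (coeff q 0) (begin
  coeff p 0 + x * eval (tail' q) x    ≡⟨ cong (λ t → coeff p 0 + x * t) (sym (eval-≈ (tail' p) (tail' q) x tails′)) ⟩
  coeff p 0 + x * eval (tail' p) x    ≡⟨ sym (eval-tail p x) ⟩
  eval p x                            ≡⟨ eq ⟩
  eval q x                            ≡⟨ eval-tail q x ⟩
  coeff q 0 + x * eval (tail' q) x    ∎)
  where
  tails′ : tail' p ≈ tail' q
  tails′ j = trans (coeff-tail p j) (trans (tails j) (sym (coeff-tail q j)))
≈-from-tail-and-eval p q x tails eq (suc j) = tails j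

coeff-mulX+1-0 : ∀ q → coeff (mulX+1 q) 0 ≡ coeff q 0
coeff-mulX+1-0 q = trans (coeff-⊕ (0ℚ ∷ q) q 0) (+-identityˡ (coeff q 0))

coeff-mulX+1-suc : ∀ q j → coeff (mulX+1 q) (suc j) ≡ coeff q j + coeff q (suc j)
coeff-mulX+1-suc q j = coeff-⊕ (0ℚ ∷ q) q (suc j)

eval-shift : ∀ p x → eval (shift p) x ≡ eval p (x + 1ℚ)
eval-shift []      x = refl
eval-shift (a ∷ p) x = begin
  eval ((a ∷ []) ⊕ mulX+1 (shift p)) x
    ≡⟨ eval-⊕ (a ∷ []) (mulX+1 (shift p)) x ⟩
  eval (a ∷ []) x + eval ((0ℚ ∷ shift p) ⊕ shift p) x
    ≡⟨ cong (λ t → eval (a ∷ []) x + t) (eval-⊕ (0ℚ ∷ shift p) (shift p) x) ⟩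
  (a + x * 0ℚ) + ((0ℚ + x * eval (shift p) x) + eval (shift p) x)
    ≡⟨ cong (λ t → (a + x * 0ℚ) + ((0ℚ + x * t) + t)) (eval-shift p x) ⟩
  (a + x * 0ℚ) + ((0ℚ + x * eval p (x + 1ℚ)) + eval p (x + 1ℚ))
    ≡⟨ collect a x (eval p (x + 1ℚ)) ⟩
  a + (x + 1ℚ) * eval p (x + 1ℚ)
    ∎
  where
  collect : ∀ a x u → (a + x * 0ℚ) + ((0ℚ + x * u) + u) ≡ a + (x + 1ℚ) * u
  collect = solve-∀ ℚ-ring

coeff-shift-0 : ∀ p → coeff (shift p) 0 ≡ eval p 1ℚ
coeff-shift-0 []      = refl
coeff-shift-0 (a ∷ p) = begin
  coeff ((a ∷ []) ⊕ mulX+1 (shift p)) 0   ≡⟨ coeff-⊕ (a ∷ []) (mulX+1 (shift p)) 0 ⟩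
  a + coeff (mulX+1 (shift p)) 0          ≡⟨ cong (λ t → a + t) (coeff-mulX+1-0 (shift p)) ⟩
  a + coeff (shift p) 0                   ≡⟨ cong (λ t → a + t) (coeff-shift-0 p) ⟩
  a + eval p 1ℚ                           ≡⟨ cong (λ t → a + t) (sym (*-identityˡ (eval p 1ℚ))) ⟩
  a + 1ℚ * eval p 1ℚ                      ∎

-- euler c = θ + c, i.e. p ↦ s·p′ + c·p
euler : ℚ → Poly → Poly
euler c []      = []
euler c (a ∷ p) = (c * a) ∷ euler (c + 1ℚ) p

coeff-euler : ∀ c p i → coeff (euler c p) i ≡ (c + ι i) * coeff p i
coeff-euler c []      i       = sym (*-zeroʳ (c + ι i))
coeff-euler c (a ∷ p) zero    = cong (_* a) (sym (+-identityʳ c))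
coeff-euler c (a ∷ p) (suc i) = trans (coeff-euler (c + 1ℚ) p i) (cong (_* coeff p i) (begin
  (c + 1ℚ) + ι i   ≡⟨ +-assoc c 1ℚ (ι i) ⟩
  c + (1ℚ + ι i)   ≡⟨ cong (λ t → c + t) (sym (ι-suc i)) ⟩
  c + ι (suc i)    ∎))

eval-euler : ∀ c p x → eval (euler c p) x ≡ eval (euler 0ℚ p) x + c * eval p x
eval-euler c p x = begin
  eval (euler c p) x                          ≡⟨ eval-≈ (euler c p) (euler 0ℚ p ⊕ scale c p) x split ⟩
  eval (euler 0ℚ p ⊕ scale c p) x             ≡⟨ eval-⊕ (euler 0ℚ p) (scale c p) x ⟩
  eval (euler 0ℚ p) x + eval (scale c p) x    ≡⟨ cong (λ t → eval (euler 0ℚ p) x + t) (eval-scale c p x) ⟩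
  eval (euler 0ℚ p) x + c * eval p x          ∎
  where
  distrib : ∀ c n a → (c + n) * a ≡ (0ℚ + n) * a + c * a
  distrib = solve-∀ ℚ-ring
  split : euler c p ≈ euler 0ℚ p ⊕ scale c p
  split i = begin
    coeff (euler c p) i                               ≡⟨ coeff-euler c p i ⟩
    (c + ι i) * coeff p i                             ≡⟨ distrib c (ι i) (coeff p i) ⟩
    (0ℚ + ι i) * coeff p i + c * coeff p i            ≡⟨ sym (cong₂ _+_ (coeff-euler 0ℚ p i) (coeff-scale c p i)) ⟩
    coeff (euler 0ℚ p) i + coeff (scale c p) i        ≡⟨ sym (coeff-⊕ (euler 0ℚ p) (scale c p) i) ⟩
    coeff (euler 0ℚ p ⊕ scale c p) i                  ∎

coeff-shift-1 : ∀ p → coeff (shift p) 1 ≡ eval (euler 0ℚ p) 1ℚ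
coeff-shift-1 []      = refl
coeff-shift-1 (a ∷ p) = begin
  coeff ((a ∷ []) ⊕ mulX+1 (shift p)) 1          ≡⟨ coeff-⊕ (a ∷ []) (mulX+1 (shift p)) 1 ⟩
  0ℚ + coeff (mulX+1 (shift p)) 1                ≡⟨ cong (λ t → 0ℚ + t) (coeff-mulX+1-suc (shift p) 0) ⟩
  0ℚ + (coeff (shift p) 0 + coeff (shift p) 1)   ≡⟨ cong₂ (λ u v → 0ℚ + (u + v)) (coeff-shift-0 p) (coeff-shift-1 p) ⟩
  0ℚ + (eval p 1ℚ + eval (euler 0ℚ p) 1ℚ)        ≡⟨ rearrange a (eval p 1ℚ) (eval (euler 0ℚ p) 1ℚ) ⟩
  0ℚ * a + 1ℚ * (eval (euler 0ℚ p) 1ℚ + 1ℚ * eval p 1ℚ)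
                                                 ≡⟨ cong (λ t → 0ℚ * a + 1ℚ * t) (sym (eval-euler 1ℚ p 1ℚ)) ⟩
  0ℚ * a + 1ℚ * eval (euler 1ℚ p) 1ℚ             ∎
  where
  rearrange : ∀ a u v → 0ℚ + (u + v) ≡ 0ℚ * a + 1ℚ * (v + 1ℚ * u)
  rearrange = solve-∀ ℚ-ring

X-1^ : ℕ → Poly
X-1^ zero    = 1ℚ ∷ []
X-1^ (suc k) = (0ℚ ∷ X-1^ k) ⊖ X-1^ k

coeff-X-1^-0 : ∀ k → coeff (X-1^ k) 0 ≡ sign k
coeff-X-1^-0 zero    = refl
coeff-X-1^-0 (suc k) = begin
  coeff (X-1^ (suc k)) 0     ≡⟨ coeff-⊖ (0ℚ ∷ X-1^ k) (X-1^ k) 0 ⟩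
  0ℚ - coeff (X-1^ k) 0      ≡⟨ +-identityˡ _ ⟩
  - coeff (X-1^ k) 0         ≡⟨ cong -_ (coeff-X-1^-0 k) ⟩
  - sign k                   ≡⟨ sym (sign-suc k) ⟩
  sign (suc k)               ∎

eval-X-1^-1 : ∀ k → eval (X-1^ (suc k)) 1ℚ ≡ 0ℚ
eval-X-1^-1 k = trans (eval-⊖ (0ℚ ∷ X-1^ k) (X-1^ k) 1ℚ) (cancel (eval (X-1^ k) 1ℚ))
  where
  cancel : ∀ u → (0ℚ + 1ℚ * u) - u ≡ 0ℚ
  cancel = solve-∀ ℚ-ring

X-1^-deriv : ∀ k i → ι i * coeff (X-1^ (suc k)) i ≡ ι (suc k) * coeff (0ℚ ∷ X-1^ k) i
X-1^-deriv k       zero          = trans (*-zeroˡ (coeff (X-1^ (suc k)) 0)) (sym (*-zeroʳ (ι (suc k))))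
X-1^-deriv zero    (suc zero)    = refl
X-1^-deriv zero    (suc (suc j)) = *-zeroʳ (ι (suc (suc j)))
X-1^-deriv (suc k) (suc j)       = begin
  ι (suc j) * coeff (X-1^ (suc (suc k))) (suc j)
                                              ≡⟨ cong₂ _*_ (ι-suc j) (coeff-⊖ (0ℚ ∷ X-1^ (suc k)) (X-1^ (suc k)) (suc j)) ⟩
  (1ℚ + ι j) * (u - w)                        ≡⟨ step₁ (ι j) u w ⟩
  (u + ι j * u) - (1ℚ + ι j) * w              ≡⟨ cong₂ (λ a b → (u + a) - b) (X-1^-deriv k j)
                                                   (trans (cong (_* w) (sym (ι-suc j))) (X-1^-deriv k (suc j))) ⟩
  (u + K * coeff (0ℚ ∷ P) j) - K * coeff P j  ≡⟨ step₂ u K (coeff (0ℚ ∷ P) j) (coeff P j) ⟩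
  (1ℚ + K) * u + K * ((coeff (0ℚ ∷ P) j - coeff P j) - u)
                                              ≡⟨ cong₂ (λ a b → a * u + K * (b - u)) (sym (ι-suc (suc k))) (sym (coeff-⊖ (0ℚ ∷ P) P j)) ⟩
  ι (suc (suc k)) * u + K * (u - u)           ≡⟨ cong (λ t → ι (suc (suc k)) * u + K * t) (+-inverseʳ u) ⟩
  ι (suc (suc k)) * u + K * 0ℚ                ≡⟨ trans (cong (λ t → ι (suc (suc k)) * u + t) (*-zeroʳ K)) (+-identityʳ _) ⟩
  ι (suc (suc k)) * u                         ∎
  where
  P = X-1^ k
  K = ι (suc k)
  u = coeff (X-1^ (suc k)) j
  w = coeff (X-1^ (suc k)) (suc j)
  step₁ : ∀ n u w → (1ℚ + n) * (u - w) ≡ (u + n * u) - (1ℚ + n) * w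
  step₁ = solve-∀ ℚ-ring
  step₂ : ∀ u K a b → (u + K * a) - K * b ≡ (1ℚ + K) * u + K * ((a - b) - u)
  step₂ = solve-∀ ℚ-ring

E : ℕ → Poly
E k = scale (invFact k) (X-1^ k ⊖ monomial k 1ℚ)

coeff-E : ∀ k i → coeff (E k) i ≡ invFact k * (coeff (X-1^ k) i - coeff (monomial k 1ℚ) i)
coeff-E k i = trans (coeff-scale (invFact k) (X-1^ k ⊖ monomial k 1ℚ) i)
                    (cong (invFact k *_) (coeff-⊖ (X-1^ k) (monomial k 1ℚ) i))

E-zero : E 0 ≈ []
E-zero i = trans (coeff-E 0 i) (trans (cong (invFact 0 *_) (+-inverseʳ (coeff (1ℚ ∷ []) i))) (*-zeroʳ (invFact 0)))

E-deriv : ∀ k j → coeff (E (suc k)) (suc j) ≡ coeff (E k) j * ι⁻¹ (suc j)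
E-deriv k j = begin
  coeff (E (suc k)) (suc j)                        ≡⟨ coeff-E (suc k) (suc j) ⟩
  invFact (suc k) * (P′ - δ)                       ≡⟨ cong (_* (P′ - δ)) (invFact-suc k) ⟩
  ι⁻¹ (suc k) * r * (P′ - δ)                       ≡⟨ distrib (ι⁻¹ (suc k)) r P′ δ ⟩
  r * (ι⁻¹ (suc k) * P′) - r * (δ * ι⁻¹ (suc k))   ≡⟨ cong₂ (λ a b → r * a - r * b) P′-scaled
                                                        (sym (coeff-monomial-supp k 1ℚ j (λ i → ι⁻¹ (suc i)))) ⟩
  r * (P * ι⁻¹ (suc j)) - r * (δ * ι⁻¹ (suc j))    ≡⟨ factor r P δ (ι⁻¹ (suc j)) ⟩
  r * (P - δ) * ι⁻¹ (suc j)                        ≡⟨ cong (_* ι⁻¹ (suc j)) (sym (coeff-E k j)) ⟩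
  coeff (E k) j * ι⁻¹ (suc j)                      ∎
  where
  r  = invFact k
  P′ = coeff (X-1^ (suc k)) (suc j)
  P  = coeff (X-1^ k) j
  δ  = coeff (monomial k 1ℚ) j
  P′-scaled : ι⁻¹ (suc k) * P′ ≡ P * ι⁻¹ (suc j)
  P′-scaled = ι-cross (suc k) (suc j) (X-1^-deriv k (suc j))
  distrib : ∀ a r p d → a * r * (p - d) ≡ r * (a * p) - r * (d * a)
  distrib = solve-∀ ℚ-ring
  factor : ∀ r p d b → r * (p * b) - r * (d * b) ≡ r * (p - d) * b
  factor = solve-∀ ℚ-ring

eval-E-1 : ∀ k → eval (E (suc k)) 1ℚ ≡ - invFact (suc k)
eval-E-1 k = begin
  eval (E (suc k)) 1ℚ
    ≡⟨ eval-scale r (X-1^ (suc k) ⊖ monomial (suc k) 1ℚ) 1ℚ ⟩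
  r * eval (X-1^ (suc k) ⊖ monomial (suc k) 1ℚ) 1ℚ
    ≡⟨ cong (r *_) (eval-⊖ (X-1^ (suc k)) (monomial (suc k) 1ℚ) 1ℚ) ⟩
  r * (eval (X-1^ (suc k)) 1ℚ - eval (monomial (suc k) 1ℚ) 1ℚ)
    ≡⟨ cong₂ (λ a b → r * (a - b)) (eval-X-1^-1 k) (eval-monomial-1 (suc k) 1ℚ) ⟩
  r * (0ℚ - 1ℚ)
    ≡⟨ times-neg-one r ⟩
  - r
    ∎
  where
  r = invFact (suc k)
  times-neg-one : ∀ r → r * (0ℚ - 1ℚ) ≡ - r
  times-neg-one = solve-∀ ℚ-ring

coeff-E-0 : ∀ k → coeff (E (suc k)) 0 ≡ invFact (suc k) * sign (suc k)
coeff-E-0 k = trans (coeff-E (suc k) 0)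
  (cong (invFact (suc k) *_) (trans (+-identityʳ (coeff (X-1^ (suc k)) 0)) (coeff-X-1^-0 (suc k))))

-- the derivative of Bpoly (suc k)
Bpoly′ : ℕ → Poly
Bpoly′ k = Bpoly k ⊖ monomial k (invFact (suc k))

eval-Bpoly-1 : ∀ k → eval (Bpoly k) 1ℚ ≡ 0ℚ
eval-Bpoly-1 zero    = refl
eval-Bpoly-1 (suc k) = trans (eval-⊖ Q (eval Q 1ℚ ∷ []) 1ℚ) (cancel (eval Q 1ℚ))
  where
  Q = integ (Bpoly′ k)
  cancel : ∀ u → u - (u + 1ℚ * 0ℚ) ≡ 0ℚ
  cancel = solve-∀ ℚ-ring

eval-Bpoly′-1 : ∀ k → eval (Bpoly′ k) 1ℚ ≡ - invFact (suc k)
eval-Bpoly′-1 k = begin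
  eval (Bpoly′ k) 1ℚ                          ≡⟨ eval-⊖ (Bpoly k) (monomial k (invFact (suc k))) 1ℚ ⟩
  eval (Bpoly k) 1ℚ - eval (monomial k (invFact (suc k))) 1ℚ
                                              ≡⟨ cong₂ _-_ (eval-Bpoly-1 k) (eval-monomial-1 k (invFact (suc k))) ⟩
  0ℚ - invFact (suc k)                        ≡⟨ +-identityˡ (- invFact (suc k)) ⟩
  - invFact (suc k)                           ∎

coeff-Bpoly-suc : ∀ k j → coeff (Bpoly (suc k)) (suc j) ≡ coeff (Bpoly′ k) j * ι⁻¹ (suc j)
coeff-Bpoly-suc k j = trans (coeff-⊖-const (integ (Bpoly′ k)) (eval (integ (Bpoly′ k)) 1ℚ) j) (coeff-integ (Bpoly′ k) j)

Bpoly-slope-1 : ∀ k → eval (euler 0ℚ (Bpoly (suc k))) 1ℚ ≡ - invFact (suc k)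
Bpoly-slope-1 k = begin
  eval (euler 0ℚ (Bpoly (suc k))) 1ℚ    ≡⟨ eval-≈ (euler 0ℚ (Bpoly (suc k))) (0ℚ ∷ Bpoly′ k) 1ℚ slope ⟩
  0ℚ + 1ℚ * eval (Bpoly′ k) 1ℚ          ≡⟨ trans (+-identityˡ _) (*-identityˡ _) ⟩
  eval (Bpoly′ k) 1ℚ                    ≡⟨ eval-Bpoly′-1 k ⟩
  - invFact (suc k)                     ∎
  where
  slope : euler 0ℚ (Bpoly (suc k)) ≈ 0ℚ ∷ Bpoly′ k
  slope zero    = trans (coeff-euler 0ℚ (Bpoly (suc k)) 0) (*-zeroˡ (coeff (Bpoly (suc k)) 0))
  slope (suc j) = begin
    coeff (euler 0ℚ (Bpoly (suc k))) (suc j)          ≡⟨ coeff-euler 0ℚ (Bpoly (suc k)) (suc j) ⟩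
    (0ℚ + ι (suc j)) * coeff (Bpoly (suc k)) (suc j)  ≡⟨ cong₂ _*_ (+-identityˡ (ι (suc j))) (coeff-Bpoly-suc k j) ⟩
    ι (suc j) * (coeff (Bpoly′ k) j * ι⁻¹ (suc j))    ≡⟨ ι*[x*ι⁻¹] (suc j) (coeff (Bpoly′ k) j) ⟩
    coeff (Bpoly′ k) j                                ∎

euler-Bpoly′ : ∀ k → euler (- ι k) (Bpoly k) ≈ E k → euler (- ι k) (Bpoly′ k) ≈ E k
euler-Bpoly′ k ih i = begin
  coeff (euler (- ι k) (Bpoly′ k)) i        ≡⟨ coeff-euler (- ι k) (Bpoly′ k) i ⟩
  f i * coeff (Bpoly′ k) i                  ≡⟨ cong (f i *_) (coeff-⊖ (Bpoly k) (monomial k a) i) ⟩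
  f i * (coeff (Bpoly k) i - m)             ≡⟨ distrib (f i) (coeff (Bpoly k) i) m ⟩
  f i * coeff (Bpoly k) i - m * f i         ≡⟨ cong₂ _-_ (sym (coeff-euler (- ι k) (Bpoly k) i))
                                                 (coeff-monomial-supp k a i f) ⟩
  coeff (euler (- ι k) (Bpoly k)) i - m * f k
                                            ≡⟨ cong₂ (λ u v → u - m * v) (ih i) (+-inverseˡ (ι k)) ⟩
  coeff (E k) i - m * 0ℚ                    ≡⟨ drop (coeff (E k) i) m ⟩
  coeff (E k) i                             ∎
  where
  a = invFact (suc k)
  m = coeff (monomial k a) i
  f : ℕ → ℚ
  f i = - ι k + ι i
  distrib : ∀ x b m → x * (b - m) ≡ x * b - m * x
  distrib = solve-∀ ℚ-ring
  drop : ∀ e m → e - m * 0ℚ ≡ e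
  drop = solve-∀ ℚ-ring

euler-Bpoly : ∀ k → euler (- ι k) (Bpoly k) ≈ E k
euler-Bpoly zero    i = sym (E-zero i)
euler-Bpoly (suc k) = ≈-from-tail-and-eval (euler (- ι (suc k)) B′) (E (suc k)) 1ℚ higher at-1
  where
  B′ = Bpoly (suc k)
  higher : ∀ j → coeff (euler (- ι (suc k)) B′) (suc j) ≡ coeff (E (suc k)) (suc j)
  higher j = begin
    coeff (euler (- ι (suc k)) B′) (suc j)              ≡⟨ coeff-euler (- ι (suc k)) B′ (suc j) ⟩
    (- ι (suc k) + ι (suc j)) * coeff B′ (suc j)        ≡⟨ cong₂ _*_ index-shift (coeff-Bpoly-suc k j) ⟩
    (- ι k + ι j) * (coeff (Bpoly′ k) j * ι⁻¹ (suc j)) ≡⟨ sym (*-assoc (- ι k + ι j) (coeff (Bpoly′ k) j) (ι⁻¹ (suc j))) ⟩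
    (- ι k + ι j) * coeff (Bpoly′ k) j * ι⁻¹ (suc j)   ≡⟨ cong (_* ι⁻¹ (suc j)) (sym (coeff-euler (- ι k) (Bpoly′ k) j)) ⟩
    coeff (euler (- ι k) (Bpoly′ k)) j * ι⁻¹ (suc j)   ≡⟨ cong (_* ι⁻¹ (suc j)) (euler-Bpoly′ k (euler-Bpoly k) j) ⟩
    coeff (E k) j * ι⁻¹ (suc j)                        ≡⟨ sym (E-deriv k j) ⟩
    coeff (E (suc k)) (suc j)                          ∎
    where
    cancel-one : ∀ x y → - (1ℚ + x) + (1ℚ + y) ≡ - x + y
    cancel-one = solve-∀ ℚ-ring
    index-shift : - ι (suc k) + ι (suc j) ≡ - ι k + ι j
    index-shift = trans (cong₂ (λ x y → - x + y) (ι-suc k) (ι-suc j)) (cancel-one (ι k) (ι j))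
  at-1 : eval (euler (- ι (suc k)) B′) 1ℚ ≡ eval (E (suc k)) 1ℚ
  at-1 = begin
    eval (euler (- ι (suc k)) B′) 1ℚ                         ≡⟨ eval-euler (- ι (suc k)) B′ 1ℚ ⟩
    eval (euler 0ℚ B′) 1ℚ + - ι (suc k) * eval B′ 1ℚ          ≡⟨ cong₂ (λ u v → u + - ι (suc k) * v) (Bpoly-slope-1 k) (eval-Bpoly-1 (suc k)) ⟩
    - invFact (suc k) + - ι (suc k) * 0ℚ                    ≡⟨ trans (cong (λ t → - invFact (suc k) + t) (*-zeroʳ (- ι (suc k)))) (+-identityʳ _) ⟩
    - invFact (suc k)                                       ≡⟨ sym (eval-E-1 k) ⟩
    eval (E (suc k)) 1ℚ                                     ∎

eval-tail-shift-0 : ∀ p → eval (tail' (shift p)) 0ℚ ≡ eval (euler 0ℚ p) 1ℚ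
eval-tail-shift-0 p = trans (eval-0 (tail' (shift p))) (trans (coeff-tail (shift p) 0) (coeff-shift-1 p))

eval-tail-shift : ∀ p x → x * eval (tail' (shift p)) x ≡ eval p (x + 1ℚ) - eval p 1ℚ
eval-tail-shift p x = begin
  x * T                                    ≡⟨ sym (add-sub (coeff (shift p) 0) (x * T)) ⟩
  (coeff (shift p) 0 + x * T) - coeff (shift p) 0
                                           ≡⟨ cong₂ _-_ (sym (eval-tail (shift p) x)) (coeff-shift-0 p) ⟩
  eval (shift p) x - eval p 1ℚ             ≡⟨ cong (_- eval p 1ℚ) (eval-shift p x) ⟩
  eval p (x + 1ℚ) - eval p 1ℚ              ∎
  where
  T = eval (tail' (shift p)) x
  add-sub : ∀ a b → (a + b) - a ≡ b
  add-sub = solve-∀ ℚ-ring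

eval-C-0 : ∀ m → eval (C (suc (suc m))) 0ℚ ≡ 1ℚ
eval-C-0 m = begin
  eval (C (suc (suc m))) 0ℚ                        ≡⟨ eval-scale (- fact (suc m)) (tail' (shift B′)) 0ℚ ⟩
  - fact (suc m) * eval (tail' (shift B′)) 0ℚ      ≡⟨ cong (- fact (suc m) *_) (trans (eval-tail-shift-0 B′) (Bpoly-slope-1 m)) ⟩
  - fact (suc m) * - invFact (suc m)               ≡⟨ neg-neg (fact (suc m)) (invFact (suc m)) ⟩
  fact (suc m) * invFact (suc m)                   ≡⟨ fact*invFact (suc m) ⟩
  1ℚ                                               ∎
  where
  B′ = Bpoly (suc m)
  neg-neg : ∀ a b → - a * - b ≡ a * b
  neg-neg = solve-∀ ℚ-ring

eval-C-neg1 : ∀ m → eval (C (suc (suc m))) (- 1ℚ) ≡ fact (suc m) * eval (B (suc (suc m))) 0ℚ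
eval-C-neg1 m = begin
  eval (C (suc (suc m))) (- 1ℚ)                    ≡⟨ eval-scale (- F) (tail' (shift B′)) (- 1ℚ) ⟩
  - F * eval (tail' (shift B′)) (- 1ℚ)             ≡⟨ regroup F (eval (tail' (shift B′)) (- 1ℚ)) ⟩
  F * (- 1ℚ * eval (tail' (shift B′)) (- 1ℚ))      ≡⟨ cong (F *_) (eval-tail-shift B′ (- 1ℚ)) ⟩
  F * (eval B′ (- 1ℚ + 1ℚ) - eval B′ 1ℚ)           ≡⟨ cong (λ t → F * (eval B′ 0ℚ - t)) (eval-Bpoly-1 (suc m)) ⟩
  F * (eval B′ 0ℚ - 0ℚ)                            ≡⟨ cong (F *_) (+-identityʳ (eval B′ 0ℚ)) ⟩
  F * eval B′ 0ℚ                                   ∎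
  where
  F  = fact (suc m)
  B′ = Bpoly (suc m)
  regroup : ∀ a t → - a * t ≡ a * (- 1ℚ * t)
  regroup = solve-∀ ℚ-ring

fact*eval-B-0 : ∀ m → fact (suc m) * eval (B (suc (suc m))) 0ℚ ≡ (-[1+ 0 ] ^ suc (suc m)) / suc m
fact*eval-B-0 m = begin
  F * eval B′ 0ℚ                     ≡⟨ cong (F *_) (eval-0 B′) ⟩
  F * b                              ≡⟨ sym (ι*[x*ι⁻¹] k (F * b)) ⟩
  ι k * (F * b * ι⁻¹ k)              ≡⟨ regroup (ι k) F b (ι⁻¹ k) ⟩
  - (F * (- ι k * b)) * ι⁻¹ k        ≡⟨ cong (λ t → - (F * t) * ι⁻¹ k) constant-term ⟩
  - (F * (r * sign k)) * ι⁻¹ k       ≡⟨ cong (_* ι⁻¹ k) (reassoc F r (sign k)) ⟩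
  - (F * r) * sign k * ι⁻¹ k         ≡⟨ cong (λ t → - t * sign k * ι⁻¹ k) (fact*invFact k) ⟩
  - 1ℚ * sign k * ι⁻¹ k              ≡⟨ cong (_* ι⁻¹ k) (sym (/1-homo-* -[1+ 0 ] (-[1+ 0 ] ^ k))) ⟩
  sign (suc k) * ι⁻¹ k               ≡⟨ sym (/-as-*ι⁻¹ (-[1+ 0 ] ^ suc k) k) ⟩
  (-[1+ 0 ] ^ suc k) / k             ∎
  where
  k  = suc m
  F  = fact k
  r  = invFact k
  B′ = Bpoly k
  b  = coeff B′ 0
  constant-term : - ι k * b ≡ r * sign k
  constant-term = begin
    - ι k * b                    ≡⟨ cong (_* b) (sym (+-identityʳ (- ι k))) ⟩
    (- ι k + ι 0) * b            ≡⟨ sym (coeff-euler (- ι k) B′ 0) ⟩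
    coeff (euler (- ι k) B′) 0   ≡⟨ euler-Bpoly k 0 ⟩
    coeff (E k) 0                ≡⟨ coeff-E-0 m ⟩
    r * sign k                   ∎
  regroup : ∀ n F b i → n * (F * b * i) ≡ - (F * (- n * b)) * i
  regroup = solve-∀ ℚ-ring
  reassoc : ∀ F r s → - (F * (r * s)) ≡ - (F * r) * s
  reassoc = solve-∀ ℚ-ring

lemma6p3 : (m : ℕ) →
    (eval (C (suc (suc m))) 0ℚ ≡ 1ℚ)
    × (eval (C (suc (suc m))) (- 1ℚ) ≡ fact (suc m) * eval (B (suc (suc m))) 0ℚ)
    × (fact (suc m) * eval (B (suc (suc m))) 0ℚ ≡ (-[1+ 0 ] ^ suc (suc m)) / suc m)
lemma6p3 m = eval-C-0 m , eval-C-neg1 m , fact*eval-B-0 m
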